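{- Let $F$ be either $\mathbb{Z}/m\mathbb{Z}$ (for a fixed positive integer $m$) or $\mathbb{Q}$, let $M$ be an $F$-module, let $s$ be a positive integer and let $A=\{a_1,\dots,a_{k}\}\subset M$ with $\operatorname{card}(A)=k$. Let $e_1,\dots,e_k$ be the canonical basis of $F^k$, let $\phi:F^k\to M$ be the $F$-linear map with $\phi(e_i)=a_i$, let $R_s\subset F^k$ be the set of elements of the form $e_{i_1}+\dots+e_{i_s}-e_{j_1}-\dots-e_{j_s}$ (indices not necessarily distinct), and let $R_s(A)=R_s\cap\ker\phi$. Let $\bar e_i$ be the image of $e_i$ in $F^k/\langle R_s(A)\rangle$ and $A_{r,s}=\{\bar e_1,\dots,\bar e_k\}$. Then the map $\bar\phi:A_{r,s}\to A$, $\bar\phi(\bar e_i)=a_i$ (induced by $\phi$), is a Freiman $s$-isomorphism.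
   Context: $\langle X\rangle$ denotes the $F$-submodule generated by $X$. For subsets $A,B$ of abelian groups, a map $\psi:A\to B$ is a Freiman $s$-homomorphism if whenever $a_1+\dots+a_s=a_1'+\dots+a_s'$ with $a_i,a_i'\in A$ we have $\psi(a_1)+\dots+\psi(a_s)=\psi(a_1')+\dots+\psi(a_s')$; it is a Freiman $s$-isomorphism if it has an inverse which is also a Freiman $s$-homomorphism. -}

module Defs where

open import Level using (Level; _⊔_) renaming (zero to 0ℓ)
import Data.Nat.Base
open Data.Nat.Base using (ℕ)
import Data.Integer.Properties as ℤP
open import Data.Integer.Divisibility.Signed using (_∣_; divides; ∣m∣n⇒∣m+n; ∣m⇒∣-m; ∣n⇒∣m*n; ∣m⇒∣m*n)
open import Data.Integer.Solver using (module +-*-Solver)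
import Data.Fin.Base as Fin
open Fin using (Fin)
open import Data.Fin.Properties using () renaming (_≟_ to _≟ᶠ_)
open import Data.Product.Base using (Σ; ∃; _×_; _,_; proj₁; proj₂)
open import Relation.Nullary.Decidable.Core using (yes; no)
open import Relation.Binary.PropositionalEquality using (_≡_; refl; sym; trans; cong; subst)
open import Relation.Binary.Structures using (IsEquivalence)
open import Relation.Unary using (Pred)
open import Algebra.Bundles using (CommutativeRing; RawMonoid)
open import Algebra.Structures using (IsCommutativeRing)
open import Algebra.Module.Bundles using (Module)
import Algebra.Definitions.RawMonoid as RMDefs

-- The ring ℤ/mℤ, presented (as is idiomatic without quotient types) as
-- the setoid-ring with carrier ℤ and equality "congruent modulo m".

module ZMod (m : ℕ) where

  open import Data.Integer.Base using (ℤ; +_; _+_; _*_; -_; _-_; 0ℤ; 1ℤ)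

  infix 4 _≈_
  _≈_ : ℤ → ℤ → Set
  x ≈ y = (+ m) ∣ (x - y)

  private
    ∣0 : (+ m) ∣ 0ℤ
    ∣0 = divides 0ℤ refl

    ≡⇒≈ : ∀ {x y} → x ≡ y → x ≈ y
    ≡⇒≈ {x} refl = subst ((+ m) ∣_) (sym (ℤP.+-inverseʳ x)) ∣0

    resp : ∀ {a b} → a ≡ b → (+ m) ∣ a → (+ m) ∣ b
    resp eq d = subst ((+ m) ∣_) eq d

    open +-*-Solver

    id-sym : ∀ x y → - (x - y) ≡ y - x
    id-sym = solve 2 (λ x y → :- (x :- y) := y :- x) refl

    id-trans : ∀ x y z → (x - y) + (y - z) ≡ x - z
    id-trans = solve 3 (λ x y z → (x :- y) :+ (y :- z) := x :- z) refl

    id-+ : ∀ x y u v → (x - y) + (u - v) ≡ (x + u) - (y + v)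
    id-+ = solve 4 (λ x y u v → (x :- y) :+ (u :- v) := (x :+ u) :- (y :+ v)) refl

    id-* : ∀ x y u v → x * (u - v) + (x - y) * v ≡ x * u - y * v
    id-* = solve 4 (λ x y u v → x :* (u :- v) :+ (x :- y) :* v := x :* u :- y :* v) refl

    id-neg : ∀ x y → - (x - y) ≡ (- x) - (- y)
    id-neg = solve 2 (λ x y → :- (x :- y) := (:- x) :- (:- y)) refl

    ≈-equiv : IsEquivalence _≈_
    ≈-equiv = record
      { refl  = λ {x} → ≡⇒≈ {x} {x} refl
      ; sym   = λ {x} {y} d → resp (id-sym x y) (∣m⇒∣-m {+ m} {x - y} d)
      ; trans = λ {x} {y} {z} d e → resp (id-trans x y z) (∣m∣n⇒∣m+n {+ m} {x - y} {y - z} d e)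
      }

    +-cong : ∀ {x y u v} → x ≈ y → u ≈ v → x + u ≈ y + v
    +-cong {x} {y} {u} {v} d e = resp (id-+ x y u v) (∣m∣n⇒∣m+n {+ m} {x - y} {u - v} d e)

    *-cong : ∀ {x y u v} → x ≈ y → u ≈ v → x * u ≈ y * v
    *-cong {x} {y} {u} {v} d e =
      resp (id-* x y u v) (∣m∣n⇒∣m+n {+ m} {x * (u - v)} {(x - y) * v} (∣n⇒∣m*n {+ m} x {u - v} e) (∣m⇒∣m*n {+ m} {x - y} v d))

    neg-cong : ∀ {x y} → x ≈ y → - x ≈ - y
    neg-cong {x} {y} d = resp (id-neg x y) (∣m⇒∣-m {+ m} {x - y} d)

    isCR : IsCommutativeRing _≈_ _+_ _*_ -_ 0ℤ 1ℤ
    isCR = record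
      { isRing = record
        { +-isAbelianGroup = record
          { isGroup = record
            { isMonoid = record
              { isSemigroup = record
                { isMagma = record { isEquivalence = ≈-equiv ; ∙-cong = λ {x} {y} {u} {v} → +-cong {x} {y} {u} {v} }
                ; assoc = λ x y z → ≡⇒≈ (ℤP.+-assoc x y z)
                }
              ; identity = (λ x → ≡⇒≈ (ℤP.+-identityˡ x)) , (λ x → ≡⇒≈ (ℤP.+-identityʳ x))
              }
            ; inverse = (λ x → ≡⇒≈ (ℤP.+-inverseˡ x)) , (λ x → ≡⇒≈ (ℤP.+-inverseʳ x))
            ; ⁻¹-cong = λ {x} {y} → neg-cong {x} {y}
            }
          ; comm = λ x y → ≡⇒≈ (ℤP.+-comm x y)
          }
        ; *-cong = λ {x} {y} {u} {v} → *-cong {x} {y} {u} {v}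
        ; *-assoc = λ x y z → ≡⇒≈ (ℤP.*-assoc x y z)
        ; *-identity = (λ x → ≡⇒≈ (ℤP.*-identityˡ x)) , (λ x → ≡⇒≈ (ℤP.*-identityʳ x))
        ; distrib = (λ x y z → ≡⇒≈ (ℤP.*-distribˡ-+ x y z)) , (λ x y z → ≡⇒≈ (ℤP.*-distribʳ-+ x y z))
        }
      ; *-comm = λ x y → ≡⇒≈ (ℤP.*-comm x y)
      }

  ring : CommutativeRing 0ℓ 0ℓ
  ring = record { isCommutativeRing = isCR }

ℤ/_ℤ : ℕ → CommutativeRing 0ℓ 0ℓ
ℤ/ m ℤ = ZMod.ring m

-- Each ambient group is given by its underlying raw
-- monoid (carrier, equality, addition, zero); a subset is a predicate,
-- and a map between subsets is a function on the Σ-types of elements.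

Sub : ∀ {c ℓ p} (G : RawMonoid c ℓ) → Pred (RawMonoid.Carrier G) p → Set (c ⊔ p)
Sub G A = Σ (RawMonoid.Carrier G) A

IsFreimanHom : ∀ {c₁ ℓ₁ c₂ ℓ₂ p q} (G : RawMonoid c₁ ℓ₁) (H : RawMonoid c₂ ℓ₂)
               (s : ℕ) (A : Pred (RawMonoid.Carrier G) p) (B : Pred (RawMonoid.Carrier H) q)
               (ψ : Sub G A → Sub H B) → Set (c₁ ⊔ ℓ₁ ⊔ ℓ₂ ⊔ p)
IsFreimanHom G H s A B ψ =
  (x y : Fin s → Sub G A) →
  RawMonoid._≈_ G (RMDefs.sum G (λ i → proj₁ (x i))) (RMDefs.sum G (λ i → proj₁ (y i))) →
  RawMonoid._≈_ H (RMDefs.sum H (λ i → proj₁ (ψ (x i)))) (RMDefs.sum H (λ i → proj₁ (ψ (y i))))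

IsFreimanIso : ∀ {c₁ ℓ₁ c₂ ℓ₂ p q} (G : RawMonoid c₁ ℓ₁) (H : RawMonoid c₂ ℓ₂)
               (s : ℕ) (A : Pred (RawMonoid.Carrier G) p) (B : Pred (RawMonoid.Carrier H) q)
               (ψ : Sub G A → Sub H B) → Set (c₁ ⊔ ℓ₁ ⊔ c₂ ⊔ ℓ₂ ⊔ p ⊔ q)
IsFreimanIso G H s A B ψ =
  IsFreimanHom G H s A B ψ ×
  Σ (Sub H B → Sub G A) λ ψ′ →
    IsFreimanHom H G s B A ψ′ ×
    ((a : Sub G A) → RawMonoid._≈_ G (proj₁ (ψ′ (ψ a))) (proj₁ a)) ×
    ((b : Sub H B) → RawMonoid._≈_ H (proj₁ (ψ (ψ′ b))) (proj₁ b))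

module Setting {r ℓr m ℓm} (F : CommutativeRing r ℓr) (M : Module F m ℓm)
               (k : ℕ) (a : Fin k → Module.Carrierᴹ M) where

  open CommutativeRing F
  open Module M using (Carrierᴹ; _≈ᴹ_; _+ᴹ_; _*ₗ_; 0ᴹ)

  Fk : Set r
  Fk = Fin k → Carrier

  _≈ᵏ_ : Fk → Fk → Set ℓr
  x ≈ᵏ y = ∀ i → x i ≈ y i

  _+ᵏ_ : Fk → Fk → Fk
  (x +ᵏ y) i = x i + y i

  _-ᵏ_ : Fk → Fk → Fk
  (x -ᵏ y) i = x i - y i

  _·ᵏ_ : Carrier → Fk → Fk
  (c ·ᵏ x) i = c * x i

  0ᵏ : Fk
  0ᵏ i = 0#

  e : Fin k → Fk
  e i j with i ≟ᶠ j
  ... | yes _ = 1#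
  ... | no  _ = 0#

  ∑ᵏ : ∀ {n} → (Fin n → Fk) → Fk
  ∑ᵏ {ℕ.zero}  v = 0ᵏ
  ∑ᵏ {ℕ.suc n} v = v Fin.zero +ᵏ ∑ᵏ (λ t → v (Fin.suc t))

  ∑ᴹ : ∀ {n} → (Fin n → Carrierᴹ) → Carrierᴹ
  ∑ᴹ {ℕ.zero}  v = 0ᴹ
  ∑ᴹ {ℕ.suc n} v = v Fin.zero +ᴹ ∑ᴹ (λ t → v (Fin.suc t))

  φ : Fk → Carrierᴹ
  φ x = ∑ᴹ (λ i → x i *ₗ a i)

  R : ℕ → Pred Fk ℓr
  R s v = Σ (Fin s → Fin k) λ is → Σ (Fin s → Fin k) λ js →
            v ≈ᵏ (∑ᵏ (λ t → e (is t)) -ᵏ ∑ᵏ (λ t → e (js t)))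

  RA : ℕ → Pred Fk (ℓr ⊔ ℓm)
  RA s v = R s v × (φ v ≈ᴹ 0ᴹ)

  data Span {p} (X : Pred Fk p) : Pred Fk (r ⊔ ℓr ⊔ p) where
    gen   : ∀ {v} → X v → Span X v
    zer   : Span X 0ᵏ
    add   : ∀ {u v} → Span X u → Span X v → Span X (u +ᵏ v)
    smul  : ∀ c {v} → Span X v → Span X (c ·ᵏ v)
    resp  : ∀ {u v} → u ≈ᵏ v → Span X u → Span X v

  -- F^k / ⟨R_s(A)⟩ (as a setoid on F^k: x ≡ y iff x − y ∈ ⟨R_s(A)⟩),
  -- with its addition and zero
  Quot : ℕ → RawMonoid r (r ⊔ ℓr ⊔ ℓm)
  Quot s = record
    { Carrier = Fk
    ; _≈_ = λ x y → Span (RA s) (x -ᵏ y)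
    ; _∙_ = _+ᵏ_
    ; ε = 0ᵏ
    }

  Ars : (s : ℕ) → Pred Fk (r ⊔ ℓr ⊔ ℓm)
  Ars s x = ∃ λ i → RawMonoid._≈_ (Quot s) x (e i)

  Mgrp : RawMonoid m ℓm
  Mgrp = Module.+ᴹ-rawMonoid M

  Aset : Pred Carrierᴹ ℓm
  Aset y = ∃ λ i → y ≈ᴹ a i

  -- card(A) = k : the aᵢ are pairwise distinct
  Distinct : Set ℓm
  Distinct = ∀ i j → a i ≈ᴹ a j → i ≡ j

  -- The conclusion: the map φ̄ : A_{r,s} → A induced by φ (i.e. φ̄(x) = φ(x),
  -- so φ̄(ēᵢ) = aᵢ) exists and is a Freiman s-isomorphism.
  Conclusion : ℕ → Set (r ⊔ ℓr ⊔ m ⊔ ℓm)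
  Conclusion s =
    Σ (Sub (Quot s) (Ars s) → Sub Mgrp Aset) λ φ̄ →
      ((x : Sub (Quot s) (Ars s)) → proj₁ (φ̄ x) ≈ᴹ φ (proj₁ x)) ×
      IsFreimanIso (Quot s) Mgrp s (Ars s) Aset φ̄

FreimanClaim : ∀ {r ℓr} (F : CommutativeRing r ℓr) (m ℓm : Level) → Set _
FreimanClaim F m ℓm =
  (M : Module F m ℓm) (s : ℕ) → 1 Data.Nat.Base.≤ s →
  (k : ℕ) (a : Fin k → Module.Carrierᴹ M) →
  Setting.Distinct F M k a → Setting.Conclusion F M k a s

module Submission where

open import Defs
open import Data.Nat.Base using (ℕ; zero; suc; _≤_)
open import Data.Product.Base using (_×_; _,_; proj₁; proj₂)
open import Data.Rational.Properties using (+-*-commutativeRing)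

open import Level using (Level)
import Data.Fin.Base as Fin
open Fin using (Fin; punchIn)
open import Function.Base using (_∘_)
open import Data.Fin.Properties using (punchInᵢ≢i) renaming (_≟_ to _≟ᶠ_)
open import Data.Vec.Functional using (Vector)
open import Relation.Nullary.Decidable.Core using (yes; no)
open import Relation.Nullary.Negation.Core using (contradiction)
open import Relation.Binary.PropositionalEquality as ≡ using (_≢_)
open import Relation.Unary using (Pred)
open import Algebra.Bundles using (CommutativeRing)
open import Algebra.Module.Bundles using (Module)
import Algebra.Definitions.RawMonoid as RawMonoidSum
import Algebra.Properties.AbelianGroup as AbelianGroupProperties
import Algebra.Properties.CommutativeMonoid.Sum as CommutativeMonoidSum
import Algebra.Properties.Ring as RingProperties
import Relation.Binary.Reasoning.Setoid as SetoidReasoning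

-- Write x ~ y for x − y ∈ ⟨R_s(A)⟩, the equality of F^k/⟨R_s(A)⟩.
--
--  * φ is F-linear, and φ(eᵢ) = aᵢ.
--  * Since R_s(A) ⊆ ker φ and ker φ is a submodule, ⟨R_s(A)⟩ ⊆ ker φ;
--    hence x ~ y implies φ(x) = φ(y), so φ̄(x) = φ(x) is well defined on
--    A_{r,s}, lands in A, and is a Freiman s-homomorphism (φ maps sums of
--    s elements to sums of s elements).
--  * The inverse sends aᵢ to ēᵢ.  It is a Freiman s-homomorphism: if
--    a_{i₁}+…+a_{iₛ} = a_{j₁}+…+a_{jₛ}, then the relation
--    e_{i₁}+…+e_{iₛ} − e_{j₁}−…−e_{jₛ} lies in R_s and in ker φ, i.e. it
--    is a generator of ⟨R_s(A)⟩.
--  * The two maps are mutually inverse because φ(eᵢ) = aᵢ, and because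
--    an element x of A_{r,s} satisfies x ~ eᵢ for some i.

module ModuleSums {r ℓr m ℓm} {F : CommutativeRing r ℓr} (M : Module F m ℓm) where

  open Module M
  open CommutativeMonoidSum +ᴹ-commutativeMonoid public using (sum; sum-cong-≋; ∑-distrib-+)
  open CommutativeMonoidSum +ᴹ-commutativeMonoid using (sum-remove; sum-replicate-zero)
  open SetoidReasoning ≈ᴹ-setoid

  sum-zero : ∀ {n} (f : Vector Carrierᴹ n) → (∀ j → f j ≈ᴹ 0ᴹ) → sum f ≈ᴹ 0ᴹ
  sum-zero {n} f f≈0 = ≈ᴹ-trans (sum-cong-≋ f≈0) (sum-replicate-zero n)

  sum-single : ∀ {n} (f : Vector Carrierᴹ n) (i : Fin n) →
               (∀ j → j ≢ i → f j ≈ᴹ 0ᴹ) → sum f ≈ᴹ f i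
  sum-single {suc n} f i f≈0 = begin
    sum f                       ≈⟨ sum-remove f ⟩
    f i +ᴹ sum (f ∘ punchIn i)  ≈⟨ +ᴹ-congˡ (sum-zero _ (λ j → f≈0 _ (punchInᵢ≢i i j))) ⟩
    f i +ᴹ 0ᴹ                   ≈⟨ +ᴹ-identityʳ (f i) ⟩
    f i                         ∎

  *ₗ-distrib-sum : ∀ {n} c (f : Vector Carrierᴹ n) → c *ₗ sum f ≈ᴹ sum (λ j → c *ₗ f j)
  *ₗ-distrib-sum {zero}  c f = *ₗ-zeroʳ c
  *ₗ-distrib-sum {suc n} c f =
    ≈ᴹ-trans (*ₗ-distribˡ c _ _) (+ᴹ-congˡ (*ₗ-distrib-sum c (f ∘ Fin.suc)))

module Construction {r ℓr m ℓm} (F : CommutativeRing r ℓr) (M : Module F m ℓm)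
                    (k : ℕ) (a : Fin k → Module.Carrierᴹ M) where

  open Setting F M k a
  open CommutativeRing F
  open Module M using (Carrierᴹ; _≈ᴹ_; _+ᴹ_; _*ₗ_; 0ᴹ; ≈ᴹ-setoid; ≈ᴹ-refl; ≈ᴹ-sym;
    ≈ᴹ-trans; +ᴹ-cong; +ᴹ-congˡ; +ᴹ-congʳ; +ᴹ-identityˡ; +ᴹ-abelianGroup;
    *ₗ-cong; *ₗ-congʳ; *ₗ-zeroˡ; *ₗ-zeroʳ; *ₗ-distribʳ; *ₗ-identityˡ; *ₗ-assoc)
  open ModuleSums M
  open AbelianGroupProperties +-abelianGroup using (//-rightDividesˡ; ⁻¹-anti-homo‿-)
  open AbelianGroupProperties +ᴹ-abelianGroup using (identityˡ-unique)
  open RingProperties ring using (-1*x≈-x)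
  open SetoidReasoning ≈ᴹ-setoid

  ∑ᴹ≈sum : ∀ {n} (v : Vector Carrierᴹ n) → ∑ᴹ v ≈ᴹ sum v
  ∑ᴹ≈sum {zero}  v = ≈ᴹ-refl
  ∑ᴹ≈sum {suc n} v = +ᴹ-congˡ (∑ᴹ≈sum (v ∘ Fin.suc))

  ∑ᵏ≈sum : ∀ s {n} (v : Vector Fk n) → ∑ᵏ v ≈ᵏ RawMonoidSum.sum (Quot s) v
  ∑ᵏ≈sum s {zero}  v i = refl
  ∑ᵏ≈sum s {suc n} v i = +-congˡ (∑ᵏ≈sum s (v ∘ Fin.suc) i)

  φ≈sum : ∀ x → φ x ≈ᴹ sum (λ i → x i *ₗ a i)
  φ≈sum x = ∑ᴹ≈sum (λ i → x i *ₗ a i)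

  φ-cong : ∀ {x y} → x ≈ᵏ y → φ x ≈ᴹ φ y
  φ-cong {x} {y} x≈y = begin
    φ x                        ≈⟨ φ≈sum x ⟩
    sum (λ i → x i *ₗ a i)     ≈⟨ sum-cong-≋ (λ i → *ₗ-congʳ (x≈y i)) ⟩
    sum (λ i → y i *ₗ a i)     ≈⟨ φ≈sum y ⟨
    φ y                        ∎

  φ-+ : ∀ x y → φ (x +ᵏ y) ≈ᴹ φ x +ᴹ φ y
  φ-+ x y = begin
    φ (x +ᵏ y)                                       ≈⟨ φ≈sum (x +ᵏ y) ⟩
    sum (λ i → (x i + y i) *ₗ a i)                   ≈⟨ sum-cong-≋ (λ i → *ₗ-distribʳ (a i) (x i) (y i)) ⟩
    sum (λ i → x i *ₗ a i +ᴹ y i *ₗ a i)             ≈⟨ ∑-distrib-+ (λ i → x i *ₗ a i) (λ i → y i *ₗ a i) ⟩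
    sum (λ i → x i *ₗ a i) +ᴹ sum (λ i → y i *ₗ a i) ≈⟨ +ᴹ-cong (φ≈sum x) (φ≈sum y) ⟨
    φ x +ᴹ φ y                                       ∎

  φ-· : ∀ c x → φ (c ·ᵏ x) ≈ᴹ c *ₗ φ x
  φ-· c x = begin
    φ (c ·ᵏ x)                       ≈⟨ φ≈sum (c ·ᵏ x) ⟩
    sum (λ i → (c * x i) *ₗ a i)     ≈⟨ sum-cong-≋ (λ i → *ₗ-assoc c (x i) (a i)) ⟩
    sum (λ i → c *ₗ (x i *ₗ a i))    ≈⟨ *ₗ-distrib-sum c (λ i → x i *ₗ a i) ⟨
    c *ₗ sum (λ i → x i *ₗ a i)      ≈⟨ *ₗ-cong refl (φ≈sum x) ⟨
    c *ₗ φ x                         ∎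

  φ-0 : φ 0ᵏ ≈ᴹ 0ᴹ
  φ-0 = ≈ᴹ-trans (φ≈sum 0ᵏ) (sum-zero (λ i → 0# *ₗ a i) (λ i → *ₗ-zeroˡ (a i)))

  φ-sum : ∀ s {n} (v : Vector Fk n) → φ (RawMonoidSum.sum (Quot s) v) ≈ᴹ sum (φ ∘ v)
  φ-sum s {zero}  v = φ-0
  φ-sum s {suc n} v = ≈ᴹ-trans (φ-+ _ _) (+ᴹ-congˡ (φ-sum s (v ∘ Fin.suc)))

  e-diagonal : ∀ i → e i i ≈ 1#
  e-diagonal i with i ≟ᶠ i
  ... | yes _   = refl
  ... | no  i≢i = contradiction ≡.refl i≢i

  e-offDiagonal : ∀ i j → j ≢ i → e i j ≈ 0#
  e-offDiagonal i j j≢i with i ≟ᶠ j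
  ... | yes i≡j = contradiction (≡.sym i≡j) j≢i
  ... | no  _   = refl

  φ-e : ∀ i → φ (e i) ≈ᴹ a i
  φ-e i = begin
    φ (e i)                     ≈⟨ φ≈sum (e i) ⟩
    sum (λ j → e i j *ₗ a j)    ≈⟨ sum-single _ i (λ j j≢i → ≈ᴹ-trans (*ₗ-congʳ (e-offDiagonal i j j≢i)) (*ₗ-zeroˡ (a j))) ⟩
    e i i *ₗ a i                ≈⟨ *ₗ-congʳ (e-diagonal i) ⟩
    1# *ₗ a i                   ≈⟨ *ₗ-identityˡ (a i) ⟩
    a i                         ∎

  φ-difference : ∀ x y → φ (x -ᵏ y) +ᴹ φ y ≈ᴹ φ x
  φ-difference x y = ≈ᴹ-trans (≈ᴹ-sym (φ-+ (x -ᵏ y) y)) (φ-cong (λ i → //-rightDividesˡ (y i) (x i)))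

  φ-equal⇒difference∈ker : ∀ {x y} → φ x ≈ᴹ φ y → φ (x -ᵏ y) ≈ᴹ 0ᴹ
  φ-equal⇒difference∈ker {x} {y} φx≈φy =
    identityˡ-unique (φ (x -ᵏ y)) (φ y) (≈ᴹ-trans (φ-difference x y) φx≈φy)

  difference∈ker⇒φ-equal : ∀ {x y} → φ (x -ᵏ y) ≈ᴹ 0ᴹ → φ x ≈ᴹ φ y
  difference∈ker⇒φ-equal {x} {y} φ[x-y]≈0 = begin
    φ x                    ≈⟨ φ-difference x y ⟨
    φ (x -ᵏ y) +ᴹ φ y      ≈⟨ +ᴹ-congʳ φ[x-y]≈0 ⟩
    0ᴹ +ᴹ φ y              ≈⟨ +ᴹ-identityˡ (φ y) ⟩
    φ y                    ∎

  -- ker φ is a submodule, so it contains the span of any of its subsets.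
  span⊆ker : ∀ {p} {X : Pred Fk p} → (∀ {v} → X v → φ v ≈ᴹ 0ᴹ) →
             ∀ {v} → Span X v → φ v ≈ᴹ 0ᴹ
  span⊆ker X⊆ker (gen Xv)       = X⊆ker Xv
  span⊆ker X⊆ker zer            = φ-0
  span⊆ker X⊆ker (add Su Sv)    =
    ≈ᴹ-trans (φ-+ _ _) (≈ᴹ-trans (+ᴹ-cong (span⊆ker X⊆ker Su) (span⊆ker X⊆ker Sv)) (+ᴹ-identityˡ 0ᴹ))
  span⊆ker X⊆ker (smul c Sv)    =
    ≈ᴹ-trans (φ-· c _) (≈ᴹ-trans (*ₗ-cong refl (span⊆ker X⊆ker Sv)) (*ₗ-zeroʳ c))
  span⊆ker X⊆ker (resp u≈v Su)  = ≈ᴹ-trans (≈ᴹ-sym (φ-cong u≈v)) (span⊆ker X⊆ker Su)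

  span-diff-refl : ∀ {p} {X : Pred Fk p} x → Span X (x -ᵏ x)
  span-diff-refl x = resp (λ i → sym (-‿inverseʳ (x i))) zer

  span-diff-sym : ∀ {p} {X : Pred Fk p} {x y} → Span X (x -ᵏ y) → Span X (y -ᵏ x)
  span-diff-sym {x = x} {y} S =
    resp (λ i → trans (-1*x≈-x (x i - y i)) (⁻¹-anti-homo‿- (x i) (y i))) (smul (- 1#) S)

  module FreimanIsomorphism (s : ℕ) where

    φ-respects-quotient : ∀ {x y} → Span (RA s) (x -ᵏ y) → φ x ≈ᴹ φ y
    φ-respects-quotient x~y = difference∈ker⇒φ-equal (span⊆ker proj₂ x~y)

    φ-∑e : ∀ {n} (is : Fin n → Fin k) → φ (∑ᵏ (e ∘ is)) ≈ᴹ sum (a ∘ is)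
    φ-∑e is = begin
      φ (∑ᵏ (e ∘ is))                          ≈⟨ φ-cong (∑ᵏ≈sum s (e ∘ is)) ⟩
      φ (RawMonoidSum.sum (Quot s) (e ∘ is))   ≈⟨ φ-sum s (e ∘ is) ⟩
      sum (φ ∘ e ∘ is)                         ≈⟨ sum-cong-≋ (φ-e ∘ is) ⟩
      sum (a ∘ is)                             ∎

    -- If a_{i₁}+…+a_{iₛ} = a_{j₁}+…+a_{jₛ}, then e_{i₁}+…+e_{iₛ} − e_{j₁}−…−e_{jₛ}
    -- is an element of R_s(A), so ē_{i₁}+…+ē_{iₛ} = ē_{j₁}+…+ē_{jₛ}.
    relation : (is js : Fin s → Fin k) → sum (a ∘ is) ≈ᴹ sum (a ∘ js) →
               Span (RA s) (RawMonoidSum.sum (Quot s) (e ∘ is) -ᵏ RawMonoidSum.sum (Quot s) (e ∘ js))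
    relation is js ∑a≈∑a = resp (λ i → +-cong (∑ᵏ≈sum s (e ∘ is) i) (-‿cong (∑ᵏ≈sum s (e ∘ js) i)))
      (gen ((is , js , λ i → refl) , φ-equal⇒difference∈ker φ∑e≈φ∑e))
      where
        φ∑e≈φ∑e : φ (∑ᵏ (e ∘ is)) ≈ᴹ φ (∑ᵏ (e ∘ js))
        φ∑e≈φ∑e = ≈ᴹ-trans (φ-∑e is) (≈ᴹ-trans ∑a≈∑a (≈ᴹ-sym (φ-∑e js)))

    φ̄ : Sub (Quot s) (Ars s) → Sub Mgrp Aset
    φ̄ (x , i , x~eᵢ) = φ x , i , ≈ᴹ-trans (φ-respects-quotient x~eᵢ) (φ-e i)

    ψ : Sub Mgrp Aset → Sub (Quot s) (Ars s)
    ψ (_ , i , _) = e i , i , span-diff-refl (e i)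

    φ̄-freiman : IsFreimanHom (Quot s) Mgrp s (Ars s) Aset φ̄
    φ̄-freiman x y ∑x~∑y = begin
      sum (φ ∘ proj₁ ∘ x)                              ≈⟨ φ-sum s (proj₁ ∘ x) ⟨
      φ (RawMonoidSum.sum (Quot s) (proj₁ ∘ x))        ≈⟨ φ-respects-quotient ∑x~∑y ⟩
      φ (RawMonoidSum.sum (Quot s) (proj₁ ∘ y))        ≈⟨ φ-sum s (proj₁ ∘ y) ⟩
      sum (φ ∘ proj₁ ∘ y)                              ∎

    ψ-freiman : IsFreimanHom Mgrp (Quot s) s Aset (Ars s) ψ
    ψ-freiman x y ∑x≈∑y = relation (index ∘ x) (index ∘ y) (begin
      sum (a ∘ index ∘ x)    ≈⟨ sum-cong-≋ (proj₂ ∘ proj₂ ∘ x) ⟨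
      sum (proj₁ ∘ x)        ≈⟨ ∑x≈∑y ⟩
      sum (proj₁ ∘ y)        ≈⟨ sum-cong-≋ (proj₂ ∘ proj₂ ∘ y) ⟩
      sum (a ∘ index ∘ y)    ∎)
      where
        index : Sub Mgrp Aset → Fin k
        index = proj₁ ∘ proj₂

    conclusion : Conclusion s
    conclusion = φ̄ , (λ _ → ≈ᴹ-refl) , φ̄-freiman , ψ , ψ-freiman , ψ∘φ̄ , φ̄∘ψ
      where
        ψ∘φ̄ : (x : Sub (Quot s) (Ars s)) → Span (RA s) (proj₁ (ψ (φ̄ x)) -ᵏ proj₁ x)
        ψ∘φ̄ (_ , _ , x~eᵢ) = span-diff-sym x~eᵢ

        φ̄∘ψ : (y : Sub Mgrp Aset) → φ (proj₁ (ψ y)) ≈ᴹ proj₁ y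
        φ̄∘ψ (_ , i , y≈aᵢ) = ≈ᴹ-trans (φ-e i) (≈ᴹ-sym y≈aᵢ)

freimanClaim : ∀ {r ℓr} (F : CommutativeRing r ℓr) (m ℓm : Level) → FreimanClaim F m ℓm
freimanClaim F m ℓm M s _ k a _ = Construction.FreimanIsomorphism.conclusion F M k a s

lemma1 : ∀ {m ℓm} →
    ((q : ℕ) → 1 ≤ q → FreimanClaim (ℤ/ q ℤ) m ℓm) × FreimanClaim +-*-commutativeRing m ℓm
lemma1 {m} {ℓm} = (λ q _ → freimanClaim (ℤ/ q ℤ) m ℓm) , freimanClaim +-*-commutativeRing m ℓm
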